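{- Let $T$ be a rooted tree. For any multiset $S$ of vertices of $T$, $$\mathbf{x}_{f_S}=\sigma\left(\mathbf{x}_h\,\tau\left(\prod_{g\in S}\sigma^{h_S(g)}(\mathbf{x}_h|_g)\right)\right).$$
   Context: $T$ is a finite rooted tree with root $v_T$; $h_v$ is the coheight of $v$ (length of the path from $v_T$ to $v$); $S_v$ is the subtree consisting of $v$ and its descendants. Indeterminates $x_i$ are indexed by $i\in\mathbb{N}$. The coheight profile is $\mathbf{x}_h=\prod_{v\in V(T)}x_{h_v}$ and the coheight profile of $v$ is $\mathbf{x}_h|_v=\prod_{u\in V(S_v)}x_{h_u}$ (coheights measured in $T$). For a multiset $S$ of vertices, $f_S(v)=1+h_v+\sum_{g\in S}\mathbb{1}_{V(S_g)}(v)$ (with multiplicity) and $\mathbf{x}_{f_S}=\prod_{v}x_{f_S(v)}$. The shift $\sigma$ sends $k\prod_i x_i^{e_i}$ to $k\prod_i x_{i+1}^{e_i}$ (extended multiplicatively to Laurent monomials), $\sigma^s$ is its $s$-fold iterate, and $\tau(\mathbf{x})=\sigma(\mathbf{x})/\mathbf{x}$ for Laurent monomials $\mathbf{x}$. The elevation function $h_S$ assigns to each occurrence of an element $g$ in $S$ the number of elements of $S$ (with multiplicity) that are ancestors of $g$ or equal to $g$, not counting that occurrence itself; when a vertex occurs several times in $S$, its copies are ordered arbitrarily and receive consecutive values (e.g. if the root occurs three times, the copies get $0,1,2$). The product over $g\in S$ runs over all occurrences. -}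

module Defs where

open import Data.Nat using (ℕ; zero; suc; _+_; _≡ᵇ_)
open import Data.Integer using (ℤ; 0ℤ; 1ℤ; -_) renaming (_+_ to _+ℤ_)
open import Data.Fin using (Fin)
open import Data.Fin.Properties using (_≟_)
open import Data.List using (List; []; _∷_; map; concatMap; _++_; [_]; foldr)
open import Data.List using () renaming (allFin to allFinL)
open import Data.Bool using (Bool; true; false; _∧_; not; if_then_else_)
open import Relation.Nullary using (yes; no)
open import Relation.Binary.PropositionalEquality using (refl)

data Tree : Set where
  node : (n : ℕ) → (Fin n → Tree) → Tree

data Pos : Tree → Set where
  root : ∀ {t} → Pos t
  sub  : ∀ {n f} (i : Fin n) → Pos (f i) → Pos (node n f)

allPos : (t : Tree) → List (Pos t)
allPos (node n f) = root ∷ concatMap (λ i → map (sub i) (allPos (f i))) (allFinL n)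

depth : ∀ {t} → Pos t → ℕ
depth root      = 0
depth (sub i p) = suc (depth p)

_≼_ : ∀ {t} → Pos t → Pos t → Bool
root    ≼ _       = true
sub i p ≼ root    = false
sub i p ≼ sub j q with i ≟ j
... | yes refl = p ≼ q
... | no _     = false

_≺_ : ∀ {t} → Pos t → Pos t → Bool
g ≺ v = (g ≼ v) ∧ not (v ≼ g)

count : ∀ {A : Set} → (A → Bool) → List A → ℕ
count P []       = 0
count P (x ∷ xs) = if P x then suc (count P xs) else count P xs

-- Laurent monomials in x_0, x_1, ... (coefficient 1), represented by
-- their exponent vector ℕ → ℤ (only finitely many nonzero in practice).
-- Equality of monomials is stated pointwise.

Mono : Set
Mono = ℕ → ℤ

one : Mono
one _ = 0ℤ

var : ℕ → Mono
var k i = if k ≡ᵇ i then 1ℤ else 0ℤ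

_·_ : Mono → Mono → Mono
(m · m') i = m i +ℤ m' i

inv : Mono → Mono
inv m i = - m i

prodL : List Mono → Mono
prodL = foldr _·_ one

σ : Mono → Mono
σ m zero    = 0ℤ
σ m (suc i) = m i

σ^ : ℕ → Mono → Mono
σ^ zero    m = m
σ^ (suc s) m = σ (σ^ s m)

τ : Mono → Mono
τ m = σ m · inv m

xh : (t : Tree) → Mono
xh t = prodL (map (λ v → var (depth v)) (allPos t))

xhAt : (t : Tree) → Pos t → Mono
xhAt t g = prodL (map (λ u → if g ≼ u then var (depth u) else one) (allPos t))

fS : (t : Tree) → List (Pos t) → Pos t → ℕ
fS t S v = suc (depth v + count (λ g → g ≼ v) S)

xfS : (t : Tree) → List (Pos t) → Mono
xfS t S = prodL (map (λ v → var (fS t S v)) (allPos t))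

-- Elevation of an occurrence g of S, where S = pre ++ g ∷ suf:
-- the other occurrences that are strict ancestors of g, plus the copies of g
-- occurring earlier in the list (copies of the same vertex are ordered by
-- their position in the list, receiving consecutive values).
elevation : ∀ {t} → List (Pos t) → Pos t → List (Pos t) → ℕ
elevation pre g suf = count (λ g' → g' ≼ g) pre + count (λ g' → g' ≺ g) suf

-- ∏_{g ∈ S} σ^{h_S(g)}(x_h|_g), product over all occurrences;
-- the first argument is the already-traversed prefix of S.
prodOccFrom : (t : Tree) → List (Pos t) → List (Pos t) → Mono
prodOccFrom t pre []        = one
prodOccFrom t pre (g ∷ suf) =
  σ^ (elevation pre g suf) (xhAt t g) · prodOccFrom t (pre ++ [ g ]) suf

prodOcc : (t : Tree) → List (Pos t) → Mono
prodOcc t S = prodOccFrom t [] S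

-- Compare the exponents of x_{j+1} on both sides.  The elements of S lying above a
-- vertex u form a chain of ancestors, and the elevation of such an occurrence is its
-- rank in that chain (copies of one vertex ranked by position in S), so these
-- elevations are exactly 0, 1, …, c_u - 1, where c_u is their number.  Hence
-- ∏_{g ∈ S} σ^{h_S(g)}(x_h|_g) = ∏_u x_{h_u} x_{h_u + 1} ⋯ x_{h_u + c_u - 1}, and τ
-- telescopes the factor of u to x_{h_u + c_u} / x_{h_u}, which turns x_h into
-- ∏_u x_{h_u + c_u}; the final σ gives x_{f_S}.
module Submission where

open import Defs
open import Data.Nat using (ℕ; zero; suc; _+_; _≡ᵇ_; _≤_; _<_; z≤n; s≤s)
open import Data.Nat.Properties
  using (+-comm; m≤n⇒m≤1+n; +-mono-≤; +-mono-≤-<; +-commutativeSemigroup)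
open import Algebra.Properties.CommutativeSemigroup +-commutativeSemigroup
  using (interchange; x∙yz≈y∙xz)
import Data.Integer as ℤ
import Data.Integer.Properties as ℤ
open import Data.Fin using (Fin)
open import Data.Fin.Properties using (_≟_)
open import Data.List using (List; []; _∷_; map; _++_; [_])
open import Data.List.Properties using (++-identityʳ; ++-assoc)
open import Data.List.Relation.Unary.All as All using (All; []; _∷_)
open import Data.Product using (Σ-syntax; _×_; _,_; proj₁; proj₂)
open import Data.Bool using (Bool; true; false; _∧_; not; if_then_else_)
open import Data.Bool.Properties using (∧-zeroʳ; ¬-not)
open import Relation.Nullary using (yes; no)
open import Relation.Binary.PropositionalEquality
  using (_≡_; _≢_; refl; sym; trans; cong; cong₂; _≗_; module ≡-Reasoning)

≼-sub : ∀ {n f} (i : Fin n) (p q : Pos (f i)) → (sub {n} {f} i p ≼ sub i q) ≡ (p ≼ q)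
≼-sub i p q with i ≟ i
... | yes refl = refl
... | no i≢i with () ← i≢i refl

≼-trans : ∀ {t} (x y z : Pos t) → x ≼ y ≡ true → y ≼ z ≡ true → x ≼ z ≡ true
≼-trans root      y         z         _  _  = refl
≼-trans (sub i p) (sub j q) (sub k r) xy yz with i ≟ j | j ≟ k
≼-trans (sub i p) (sub j q) (sub k r) () yz | no _     | _
≼-trans (sub i p) (sub j q) (sub k r) xy () | yes refl | no _
... | yes refl | yes refl = trans (≼-sub i p r) (≼-trans p q r xy yz)

≼-total-below : ∀ {t} (x y u : Pos t) →
  x ≼ u ≡ true → y ≼ u ≡ true → x ≼ y ≡ false → y ≼ x ≡ true
≼-total-below root      y         u         _  _  ()
≼-total-below (sub i p) root      u         _  _  _  = refl
≼-total-below (sub i p) (sub j q) (sub k w) xu yu xy with i ≟ k | j ≟ k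
≼-total-below (sub i p) (sub j q) (sub k w) () yu xy | no _     | _
≼-total-below (sub i p) (sub j q) (sub k w) xu () xy | yes refl | no _
... | yes refl | yes refl =
  trans (≼-sub i q p) (≼-total-below p q w xu yu (trans (sym (≼-sub i p q)) xy))

≺-intro : ∀ {t} (x y : Pos t) → x ≼ y ≡ true → y ≼ x ≡ false → x ≺ y ≡ true
≺-intro x y xy yx rewrite xy | yx = refl

≺-elim : ∀ {t} (x y : Pos t) → x ≺ y ≡ true → (x ≼ y ≡ true) × (y ≼ x ≡ false)
≺-elim x y x≺y with x ≼ y | y ≼ x
≺-elim x y ()  | false | _
≺-elim x y ()  | true  | true
... | true | false = refl , refl

≼⇒⊀ : ∀ {t} (x y : Pos t) → x ≼ y ≡ true → y ≺ x ≡ false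
≼⇒⊀ x y xy = trans (cong (λ b → (y ≼ x) ∧ not b) xy) (∧-zeroʳ (y ≼ x))

≺⇒≼ : ∀ {t} (x y : Pos t) → x ≺ y ≡ true → x ≼ y ≡ true
≺⇒≼ x y x≺y = proj₁ (≺-elim x y x≺y)

≺-≼-trans : ∀ {t} (x y z : Pos t) → x ≺ y ≡ true → y ≼ z ≡ true → x ≺ z ≡ true
≺-≼-trans x y z x≺y yz = ≺-intro x z (≼-trans x y z xy yz) (¬-not z⋠x)
  where
    xy = proj₁ (≺-elim x y x≺y)
    z⋠x : z ≼ x ≢ true
    z⋠x zx with () ← trans (sym (≼-trans y z x yz zx)) (proj₂ (≺-elim x y x≺y))

≼-≺-trans : ∀ {t} (x y z : Pos t) → x ≼ y ≡ true → y ≺ z ≡ true → x ≺ z ≡ true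
≼-≺-trans x y z xy y≺z = ≺-intro x z (≼-trans x y z xy yz) (¬-not z⋠x)
  where
    yz = proj₁ (≺-elim y z y≺z)
    z⋠x : z ≼ x ≢ true
    z⋠x zx with () ← trans (sym (≼-trans z x y zx xy)) (proj₂ (≺-elim y z y≺z))

count-++ : ∀ {A : Set} (P : A → Bool) (xs ys : List A) →
  count P (xs ++ ys) ≡ count P xs + count P ys
count-++ P []       ys = refl
count-++ P (x ∷ xs) ys with P x
... | true  = cong suc (count-++ P xs ys)
... | false = count-++ P xs ys

count-mono : ∀ {A : Set} {P Q : A → Bool} (xs : List A) →
  (∀ x → P x ≡ true → Q x ≡ true) → count P xs ≤ count Q xs
count-mono []       P⇒Q = z≤n
count-mono {P = P} {Q} (x ∷ xs) P⇒Q with P x in px | Q x in qx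
... | true  | true  = s≤s (count-mono xs P⇒Q)
... | false | true  = m≤n⇒m≤1+n (count-mono xs P⇒Q)
... | false | false = count-mono xs P⇒Q
... | true  | false with () ← trans (sym (P⇒Q x px)) qx

⟦_⟧ : Bool → ℕ
⟦ true  ⟧ = 1
⟦ false ⟧ = 0

sumBy : ∀ {A : Set} → (A → ℕ) → List A → ℕ
sumBy f []       = 0
sumBy f (x ∷ xs) = f x + sumBy f xs

sumBy-congᴬ : ∀ {A : Set} {P : A → Set} {f g : A → ℕ} {xs : List A} →
  All P xs → (∀ x → P x → f x ≡ g x) → sumBy f xs ≡ sumBy g xs
sumBy-congᴬ []         f≡g = refl
sumBy-congᴬ (px ∷ pxs) f≡g = cong₂ _+_ (f≡g _ px) (sumBy-congᴬ pxs f≡g)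

sumBy-cong : ∀ {A : Set} {f g : A → ℕ} (xs : List A) → f ≗ g → sumBy f xs ≡ sumBy g xs
sumBy-cong []       f≗g = refl
sumBy-cong (x ∷ xs) f≗g = cong₂ _+_ (f≗g x) (sumBy-cong xs f≗g)

sumBy-zero : ∀ {A : Set} {f : A → ℕ} (xs : List A) → f ≗ (λ _ → 0) → sumBy f xs ≡ 0
sumBy-zero []       f≗0 = refl
sumBy-zero (x ∷ xs) f≗0 = cong₂ _+_ (f≗0 x) (sumBy-zero xs f≗0)

sumBy-map : ∀ {A B : Set} (f : B → ℕ) (k : A → B) (xs : List A) →
  sumBy f (map k xs) ≡ sumBy (λ x → f (k x)) xs
sumBy-map f k []       = refl
sumBy-map f k (x ∷ xs) = cong (f (k x) +_) (sumBy-map f k xs)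

sumBy-+ : ∀ {A : Set} (f g : A → ℕ) (xs : List A) →
  sumBy (λ x → f x + g x) xs ≡ sumBy f xs + sumBy g xs
sumBy-+ f g []       = refl
sumBy-+ f g (x ∷ xs) =
  trans (cong (f x + g x +_) (sumBy-+ f g xs)) (interchange (f x) (g x) (sumBy f xs) (sumBy g xs))

sumBy-swap : ∀ {A B : Set} (f : A → B → ℕ) (xs : List A) (ys : List B) →
  sumBy (λ x → sumBy (f x) ys) xs ≡ sumBy (λ y → sumBy (λ x → f x y) xs) ys
sumBy-swap f []       ys = sym (sumBy-zero ys (λ _ → refl))
sumBy-swap f (x ∷ xs) ys =
  trans (cong (sumBy (f x) ys +_) (sumBy-swap f xs ys))
        (sym (sumBy-+ (f x) (λ y → sumBy (λ x → f x y) xs) ys))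

∑< : (ℕ → ℕ) → ℕ → ℕ
∑< F zero    = 0
∑< F (suc n) = F 0 + ∑< (λ x → F (suc x)) n

∑<-zero : ∀ {F : ℕ → ℕ} n → F ≗ (λ _ → 0) → ∑< F n ≡ 0
∑<-zero zero    F≗0 = refl
∑<-zero (suc n) F≗0 = cong₂ _+_ (F≗0 0) (∑<-zero n (λ x → F≗0 (suc x)))

∑<-telescope : ∀ (F : ℕ → ℕ) n → F n + ∑< F n ≡ F 0 + ∑< (λ x → F (suc x)) n
∑<-telescope F zero    = refl
∑<-telescope F (suc n) = begin
  F (suc n) + (F 0 + ∑< G n)  ≡⟨ x∙yz≈y∙xz (F (suc n)) (F 0) (∑< G n) ⟩
  F 0 + (G n + ∑< G n)        ≡⟨ cong (F 0 +_) (∑<-telescope G n) ⟩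
  F 0 + ∑< G (suc n)          ∎
  where
    open ≡-Reasoning
    G : ℕ → ℕ
    G x = F (suc x)

-- punchIn r enumerates ℕ ∖ {r} in increasing order.
punchIn : ℕ → ℕ → ℕ
punchIn zero    x       = suc x
punchIn (suc r) zero    = zero
punchIn (suc r) (suc x) = suc (punchIn r x)

punchIn-≥ : ∀ {r x} → r ≤ x → punchIn r x ≡ suc x
punchIn-≥ z≤n = refl
punchIn-≥ {suc r} {suc x} (s≤s r≤x) = cong suc (punchIn-≥ r≤x)

punchIn-< : ∀ {r x} → x < r → punchIn r x ≡ x
punchIn-< {suc r} {zero}  x<r       = refl
punchIn-< {suc r} {suc x} (s≤s x<r) = cong suc (punchIn-< x<r)

∑<-punchIn : ∀ (F : ℕ → ℕ) {r n} → r ≤ n → F r + ∑< (λ x → F (punchIn r x)) n ≡ ∑< F (suc n)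
∑<-punchIn F z≤n = refl
∑<-punchIn F {suc r} {suc n} (s≤s r≤n) = begin
  F (suc r) + (F 0 + ∑< (λ x → G (punchIn r x)) n) ≡⟨ x∙yz≈y∙xz (F (suc r)) (F 0) _ ⟩
  F 0 + (G r + ∑< (λ x → G (punchIn r x)) n)       ≡⟨ cong (F 0 +_) (∑<-punchIn G r≤n) ⟩
  F 0 + ∑< G (suc n)                               ∎
  where
    open ≡-Reasoning
    G : ℕ → ℕ
    G x = F (suc x)

occurrences : ∀ {t} → List (Pos t) → List (Pos t) → List (Pos t × ℕ)
occurrences pre []        = []
occurrences pre (g ∷ suf) = (g , elevation pre g suf) ∷ occurrences (pre ++ [ g ]) suf

IsOccurrence : ∀ {t} → List (Pos t) → List (Pos t) → Pos t × ℕ → Set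
IsOccurrence {t} pre suf (g , e) = Σ[ a ∈ List (Pos t) ] Σ[ b ∈ List (Pos t) ]
  (suf ≡ a ++ g ∷ b) × (e ≡ count (_≼ g) (pre ++ a) + count (_≺ g) b)

occurrences-valid : ∀ {t} (pre suf : List (Pos t)) →
  All (IsOccurrence pre suf) (occurrences pre suf)
occurrences-valid pre []        = []
occurrences-valid pre (g ∷ suf) =
  ([] , suf , refl , cong (λ l → count (_≼ g) l + count (_≺ g) suf) (sym (++-identityʳ pre)))
  ∷ All.map shift (occurrences-valid (pre ++ [ g ]) suf)
  where
    shift : ∀ {o} → IsOccurrence (pre ++ [ g ]) suf o → IsOccurrence pre (g ∷ suf) o
    shift (a , b , refl , refl) =
      g ∷ a , b , refl , cong (λ l → count _ l + _) (++-assoc pre [ g ] a)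

raise : ∀ {t} → Pos t → Pos t × ℕ → Pos t × ℕ
raise x (g , e) = g , ⟦ x ≼ g ⟧ + e

occurrences-∷ : ∀ {t} (x : Pos t) pre suf →
  occurrences (x ∷ pre) suf ≡ map (raise x) (occurrences pre suf)
occurrences-∷ x pre []        = refl
occurrences-∷ x pre (g ∷ suf) =
  cong₂ _∷_ (cong (g ,_) elevation-∷) (occurrences-∷ x (pre ++ [ g ]) suf)
  where
    elevation-∷ : elevation (x ∷ pre) g suf ≡ ⟦ x ≼ g ⟧ + elevation pre g suf
    elevation-∷ with x ≼ g
    ... | true  = refl
    ... | false = refl

-- Prepending x to S gives x the elevation count (_≺ x) S; an occurrence of g in S has
-- elevation at least that iff x ≼ g (when x and g are comparable).
elevation-≥ : ∀ {t} (x g : Pos t) (a b : List (Pos t)) → x ≼ g ≡ true →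
  count (_≺ x) (a ++ g ∷ b) ≤ count (_≼ g) a + count (_≺ g) b
elevation-≥ x g a b xg rewrite count-++ (_≺ x) a (g ∷ b) | ≼⇒⊀ x g xg =
  +-mono-≤ (count-mono a (λ y y≺x → ≺⇒≼ y g (≺-≼-trans y x g y≺x xg)))
           (count-mono b (λ y y≺x → ≺-≼-trans y x g y≺x xg))

elevation-< : ∀ {t} (x g : Pos t) (a b : List (Pos t)) → g ≺ x ≡ true →
  count (_≼ g) a + count (_≺ g) b < count (_≺ x) (a ++ g ∷ b)
elevation-< x g a b g≺x rewrite count-++ (_≺ x) a (g ∷ b) | g≺x =
  +-mono-≤-< (count-mono a (λ y yg → ≼-≺-trans y g x yg g≺x))
             (s≤s (count-mono b (λ y y≺g → ≼-≺-trans y g x (≺⇒≼ y g y≺g) g≺x)))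

below : ∀ {t} → Pos t → (ℕ → ℕ) → Pos t × ℕ → ℕ
below u F (g , e) = if g ≼ u then F e else 0

sumBy-below-raise : ∀ {t} (u x : Pos t) (F G : ℕ → ℕ) (S : List (Pos t)) →
  (∀ g a b → S ≡ a ++ g ∷ b → let e = count (_≼ g) a + count (_≺ g) b in
     below u F (raise x (g , e)) ≡ below u G (g , e)) →
  sumBy (below u F) (occurrences [ x ] S) ≡ sumBy (below u G) (occurrences [] S)
sumBy-below-raise u x F G S step = begin
  sumBy (below u F) (occurrences [ x ] S)                ≡⟨ cong (sumBy (below u F)) (occurrences-∷ x [] S) ⟩
  sumBy (below u F) (map (raise x) (occurrences [] S))  ≡⟨ sumBy-map (below u F) (raise x) (occurrences [] S) ⟩
  sumBy (λ o → below u F (raise x o)) (occurrences [] S) ≡⟨ sumBy-congᴬ (occurrences-valid [] S) step′ ⟩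
  sumBy (below u G) (occurrences [] S)                   ∎
  where
    open ≡-Reasoning
    step′ : ∀ o → IsOccurrence [] S o → below u F (raise x o) ≡ below u G o
    step′ (g , e) (a , b , S≡ , refl) = step g a b S≡

-- The elevations of the occurrences lying above u are exactly 0, …, count (_≼ u) S - 1.
sum-elevations-below : ∀ {t} (u : Pos t) (F : ℕ → ℕ) (S : List (Pos t)) →
  sumBy (below u F) (occurrences [] S) ≡ ∑< F (count (_≼ u) S)
sum-elevations-below u F [] = refl
sum-elevations-below u F (x ∷ S) with x ≼ u in xu
... | true = begin
  F r + sumBy (below u F) (occurrences [ x ] S) ≡⟨ cong (F r +_) (sumBy-below-raise u x F G S step) ⟩
  F r + sumBy (below u G) (occurrences [] S)    ≡⟨ cong (F r +_) (sum-elevations-below u G S) ⟩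
  F r + ∑< G (count (_≼ u) S)                   ≡⟨ ∑<-punchIn F r≤c ⟩
  ∑< F (suc (count (_≼ u) S))                   ∎
  where
    open ≡-Reasoning
    r = count (_≺ x) S
    G : ℕ → ℕ
    G e = F (punchIn r e)
    r≤c : r ≤ count (_≼ u) S
    r≤c = count-mono S (λ y y≺x → ≼-trans y x u (≺⇒≼ y x y≺x) xu)
    step : ∀ g a b → S ≡ a ++ g ∷ b → let e = count (_≼ g) a + count (_≺ g) b in
      below u F (raise x (g , e)) ≡ below u G (g , e)
    step g a b refl with g ≼ u in gu | x ≼ g in xg
    ... | false | _     = refl
    ... | true  | true  = cong F (sym (punchIn-≥ (elevation-≥ x g a b xg)))
    ... | true  | false = cong F (sym (punchIn-< (elevation-< x g a b g≺x)))
      where g≺x = ≺-intro g x (≼-total-below x g u xu gu xg) xg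
... | false = trans (sumBy-below-raise u x F F S step) (sum-elevations-below u F S)
  where
    step : ∀ g a b → S ≡ a ++ g ∷ b → let e = count (_≼ g) a + count (_≺ g) b in
      below u F (raise x (g , e)) ≡ below u F (g , e)
    step g a b _ with g ≼ u in gu | x ≼ g in xg
    ... | false | _     = refl
    ... | true  | false = refl
    ... | true  | true with () ← trans (sym (≼-trans x g u xg gu)) xu

_≈ℕ_ : Mono → (ℕ → ℕ) → Set
m ≈ℕ f = ∀ i → m i ≡ ℤ.+ f i

var-≈ℕ : ∀ k → var k ≈ℕ (λ i → ⟦ k ≡ᵇ i ⟧)
var-≈ℕ k i with k ≡ᵇ i
... | true  = refl
... | false = refl

prodL-map-≈ℕ : ∀ {A : Set} (F : A → Mono) (f : A → ℕ → ℕ) (xs : List A) →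
  (∀ x → F x ≈ℕ f x) → prodL (map F xs) ≈ℕ (λ i → sumBy (λ x → f x i) xs)
prodL-map-≈ℕ F f []       F≈f i = refl
prodL-map-≈ℕ F f (x ∷ xs) F≈f i = cong₂ ℤ._+_ (F≈f x i) (prodL-map-≈ℕ F f xs F≈f i)

σ-cong : ∀ {m m′} → m ≗ m′ → σ m ≗ σ m′
σ-cong m≗m′ zero    = refl
σ-cong m≗m′ (suc i) = m≗m′ i

σ-one : σ one ≗ one
σ-one zero    = refl
σ-one (suc i) = refl

σ-· : ∀ m m′ → σ (m · m′) ≗ σ m · σ m′
σ-· m m′ zero    = refl
σ-· m m′ (suc i) = refl

σ-var : ∀ k → σ (var k) ≗ var (suc k)
σ-var k zero    = refl
σ-var k (suc i) = refl

σ-prodL-map : ∀ {A : Set} (F : A → Mono) (xs : List A) →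
  σ (prodL (map F xs)) ≗ prodL (map (λ x → σ (F x)) xs)
σ-prodL-map F []       i = σ-one i
σ-prodL-map F (x ∷ xs) i =
  trans (σ-· (F x) _ i) (cong (λ z → σ (F x) i ℤ.+ z) (σ-prodL-map F xs i))

σ^-prodL-map : ∀ {A : Set} e (F : A → Mono) (xs : List A) →
  σ^ e (prodL (map F xs)) ≗ prodL (map (λ x → σ^ e (F x)) xs)
σ^-prodL-map zero    F xs i = refl
σ^-prodL-map (suc e) F xs i =
  trans (σ-cong (σ^-prodL-map e F xs) i) (σ-prodL-map (λ x → σ^ e (F x)) xs i)

σ^-one : ∀ e → σ^ e one ≗ one
σ^-one zero    i = refl
σ^-one (suc e) i = trans (σ-cong (σ^-one e) i) (σ-one i)

σ^-var : ∀ e k → σ^ e (var k) ≗ var (e + k)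
σ^-var zero    k i = refl
σ^-var (suc e) k i = trans (σ-cong (σ^-var e k) i) (σ-var (e + k) i)

σ^-xhAt-≈ℕ : ∀ t g e →
  σ^ e (xhAt t g) ≈ℕ (λ i → sumBy (λ u → if g ≼ u then ⟦ e + depth u ≡ᵇ i ⟧ else 0) (allPos t))
σ^-xhAt-≈ℕ t g e i =
  trans (σ^-prodL-map e _ (allPos t) i) (prodL-map-≈ℕ _ _ (allPos t) shifted i)
  where
    shifted : ∀ u → σ^ e (if g ≼ u then var (depth u) else one)
                      ≈ℕ (λ i → if g ≼ u then ⟦ e + depth u ≡ᵇ i ⟧ else 0)
    shifted u with g ≼ u
    ... | true  = λ i → trans (σ^-var e (depth u) i) (var-≈ℕ (e + depth u) i)
    ... | false = σ^-one e

prodOccFrom-≈ℕ : ∀ t pre S → prodOccFrom t pre S ≈ℕ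
  (λ i → sumBy (λ o → sumBy (λ u → below u (λ e → ⟦ e + depth u ≡ᵇ i ⟧) o) (allPos t))
               (occurrences pre S))
prodOccFrom-≈ℕ t pre []        i = refl
prodOccFrom-≈ℕ t pre (g ∷ suf) i =
  cong₂ ℤ._+_ (σ^-xhAt-≈ℕ t g (elevation pre g suf) i) (prodOccFrom-≈ℕ t (pre ++ [ g ]) suf i)

-- The exponent of x_i in σ^s of the product of x_{x + h_u} over u ∈ V(T) and x < c_u,
-- where c_u is the number of elements of S lying above u.
stackedExponent : (t : Tree) → List (Pos t) → ℕ → ℕ → ℕ
stackedExponent t S s i =
  sumBy (λ u → ∑< (λ x → ⟦ s + (x + depth u) ≡ᵇ i ⟧) (count (_≼ u) S)) (allPos t)

prodOcc-≈ℕ : ∀ t S → prodOcc t S ≈ℕ stackedExponent t S 0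
prodOcc-≈ℕ t S i = trans (prodOccFrom-≈ℕ t [] S i) (cong ℤ.+_ (begin
  sumBy (λ o → sumBy (λ u → below u (F u) o) (allPos t)) (occurrences [] S)
    ≡⟨ sumBy-swap (λ o u → below u (F u) o) (occurrences [] S) (allPos t) ⟩
  sumBy (λ u → sumBy (below u (F u)) (occurrences [] S)) (allPos t)
    ≡⟨ sumBy-cong (allPos t) (λ u → sum-elevations-below u (F u) S) ⟩
  stackedExponent t S 0 i ∎))
  where
    open ≡-Reasoning
    F : Pos t → ℕ → ℕ
    F u e = ⟦ e + depth u ≡ᵇ i ⟧

σ-prodOcc-≈ℕ : ∀ t S → σ (prodOcc t S) ≈ℕ stackedExponent t S 1
σ-prodOcc-≈ℕ t S zero    =
  cong ℤ.+_ (sym (sumBy-zero (allPos t) (λ u → ∑<-zero (count (_≼ u) S) (λ _ → refl))))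
σ-prodOcc-≈ℕ t S (suc i) = prodOcc-≈ℕ t S i

xfS-≈ℕ : ∀ t S → xfS t S ≈ℕ (λ i → sumBy (λ v → ⟦ fS t S v ≡ᵇ i ⟧) (allPos t))
xfS-≈ℕ t S = prodL-map-≈ℕ _ _ (allPos t) (λ v → var-≈ℕ (fS t S v))

xh-≈ℕ : ∀ t → xh t ≈ℕ (λ i → sumBy (λ v → ⟦ depth v ≡ᵇ i ⟧) (allPos t))
xh-≈ℕ t = prodL-map-≈ℕ _ _ (allPos t) (λ v → var-≈ℕ (depth v))

-- Per vertex, both sides count the exponents h_v, …, h_v + c_v once each.
exponent-balance : ∀ t S j →
  sumBy (λ v → ⟦ fS t S v ≡ᵇ suc j ⟧) (allPos t) + stackedExponent t S 0 j
    ≡ sumBy (λ v → ⟦ depth v ≡ᵇ j ⟧) (allPos t) + stackedExponent t S 1 j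
exponent-balance t S j = begin
  sumBy (λ v → ⟦ fS t S v ≡ᵇ suc j ⟧) V + sumBy (λ v → ∑< (F v) (c v)) V
    ≡⟨ sumBy-+ _ _ V ⟨
  sumBy (λ v → ⟦ depth v + c v ≡ᵇ j ⟧ + ∑< (F v) (c v)) V
    ≡⟨ sumBy-cong V telescope ⟩
  sumBy (λ v → ⟦ depth v ≡ᵇ j ⟧ + ∑< (λ x → F v (suc x)) (c v)) V
    ≡⟨ sumBy-+ _ _ V ⟩
  sumBy (λ v → ⟦ depth v ≡ᵇ j ⟧) V + stackedExponent t S 1 j ∎
  where
    open ≡-Reasoning
    V = allPos t
    c : Pos t → ℕ
    c v = count (_≼ v) S
    F : Pos t → ℕ → ℕ
    F v x = ⟦ x + depth v ≡ᵇ j ⟧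
    telescope : ∀ v → ⟦ depth v + c v ≡ᵇ j ⟧ + ∑< (F v) (c v)
                        ≡ ⟦ depth v ≡ᵇ j ⟧ + ∑< (λ x → F v (suc x)) (c v)
    telescope v = trans (cong (λ n → ⟦ n ≡ᵇ j ⟧ + ∑< (F v) (c v)) (+-comm (depth v) (c v)))
                        (∑<-telescope (F v) (c v))

m+o≡n+p⇒m≡n+p-o : ∀ {m n o p} → m + o ≡ n + p → ℤ.+ m ≡ ℤ.+ n ℤ.+ (ℤ.+ p ℤ.+ ℤ.- ℤ.+ o)
m+o≡n+p⇒m≡n+p-o {m} {n} {o} {p} eq = sym (begin
  ℤ.+ n ℤ.+ (ℤ.+ p ℤ.+ ℤ.- ℤ.+ o)   ≡⟨ ℤ.+-assoc (ℤ.+ n) (ℤ.+ p) (ℤ.- ℤ.+ o) ⟨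
  ℤ.+ (n + p) ℤ.+ ℤ.- ℤ.+ o         ≡⟨ cong (λ k → ℤ.+ k ℤ.+ ℤ.- ℤ.+ o) eq ⟨
  ℤ.+ (m + o) ℤ.+ ℤ.- ℤ.+ o         ≡⟨ ℤ.+-assoc (ℤ.+ m) (ℤ.+ o) (ℤ.- ℤ.+ o) ⟩
  ℤ.+ m ℤ.+ (ℤ.+ o ℤ.+ ℤ.- ℤ.+ o)   ≡⟨ cong (λ k → ℤ.+ m ℤ.+ k) (ℤ.+-inverseʳ (ℤ.+ o)) ⟩
  ℤ.+ m ℤ.+ ℤ.0ℤ                    ≡⟨ ℤ.+-identityʳ (ℤ.+ m) ⟩
  ℤ.+ m                             ∎)
  where open ≡-Reasoning

theorem4p11 : (t : Tree) (S : List (Pos t)) (i : ℕ) →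
    xfS t S i ≡ σ (xh t · τ (prodOcc t S)) i
theorem4p11 t S zero    = trans (xfS-≈ℕ t S 0) (cong ℤ.+_ (sumBy-zero (allPos t) (λ _ → refl)))
theorem4p11 t S (suc j) = begin
  xfS t S (suc j)
    ≡⟨ xfS-≈ℕ t S (suc j) ⟩
  ℤ.+ sumBy (λ v → ⟦ fS t S v ≡ᵇ suc j ⟧) (allPos t)
    ≡⟨ m+o≡n+p⇒m≡n+p-o (exponent-balance t S j) ⟩
  ℤ.+ sumBy (λ v → ⟦ depth v ≡ᵇ j ⟧) (allPos t)
    ℤ.+ (ℤ.+ stackedExponent t S 1 j ℤ.+ ℤ.- ℤ.+ stackedExponent t S 0 j)
    ≡⟨ cong₂ ℤ._+_ (xh-≈ℕ t j) (cong₂ ℤ._+_ (σ-prodOcc-≈ℕ t S j) (cong ℤ.-_ (prodOcc-≈ℕ t S j))) ⟨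
  σ (xh t · τ (prodOcc t S)) (suc j) ∎
  where open ≡-Reasoning
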